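{- For every positive integer $n$, the graph $C_6 \times K_n$ admits a $C_6$-decomposition.
   Context: $K_n$ is the complete graph on $n$ vertices, $C_k$ the cycle of length $k$. The tensor product $G \times H$ has vertex set $V(G)\times V(H)$, with $(g_1,h_1)$ adjacent to $(g_2,h_2)$ iff $g_1g_2 \in E(G)$ and $h_1h_2 \in E(H)$. A $C_k$-decomposition of a graph is a partition of its edge set into edge sets of subgraphs isomorphic to $C_k$. -}

module Defs where

open import Data.Nat using (ℕ; suc; _%_; NonZero)
open import Data.Nat.DivMod using (m%n<n)
open import Data.Fin using (Fin; toℕ; fromℕ<)
open import Data.Product using (_×_; ∃-syntax; _,_)
open import Function.Definitions using (Injective)
open import Relation.Binary.PropositionalEquality using (_≡_; _≢_)
open import Data.Sum using (_⊎_)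

-- A simple undirected graph, given by its vertex type and adjacency
-- relation.  (All graphs built below have symmetric, irreflexive
-- adjacency by construction.)
record Graph : Set₁ where
  field
    V   : Set
    Adj : V → V → Set
open Graph public

next : ∀ {k} .{{_ : NonZero k}} → Fin k → Fin k
next {k} i = fromℕ< (m%n<n (suc (toℕ i)) k)

C : (k : ℕ) .{{_ : NonZero k}} → Graph
C k = record { V = Fin k ; Adj = λ i j → (next i ≡ j) ⊎ (next j ≡ i) }

K : ℕ → Graph
K n = record { V = Fin n ; Adj = λ i j → i ≢ j }

_⊗_ : Graph → Graph → Graph
G ⊗ H = record
  { V   = V G × V H
  ; Adj = λ { (g₁ , h₁) (g₂ , h₂) → Adj G g₁ g₂ × Adj H h₁ h₂ } }

record CycleIn (k : ℕ) .{{_ : NonZero k}} (G : Graph) : Set where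
  field
    vert     : Fin k → V G
    distinct : Injective _≡_ _≡_ vert
    adjacent : ∀ i → Adj G (vert i) (vert (next i))
open CycleIn public

EdgeOf : ∀ {k} .{{_ : NonZero k}} {G : Graph} → CycleIn k G → V G → V G → Set
EdgeOf c u v = ∃[ i ] ((vert c i ≡ u × vert c (next i) ≡ v)
                     ⊎ (vert c i ≡ v × vert c (next i) ≡ u))

-- A C_k-decomposition of G: a finite family of k-cycles of G (each
-- subgraph is isomorphic to C_k since its k vertices are distinct) such
-- that every edge of G lies in exactly one cycle of the family; i.e.
-- the cycles' edge sets partition E(G).
record Decomposition (k : ℕ) .{{_ : NonZero k}} (G : Graph) : Set where
  field
    size    : ℕ
    cycle   : Fin size → CycleIn k G
    covers  : ∀ u v → Adj G u v → ∃[ j ] EdgeOf (cycle j) u v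
    unique  : ∀ u v → Adj G u v → ∀ j j′ →
                EdgeOf (cycle j) u v → EdgeOf (cycle j′) u v → j ≡ j′

{-# OPTIONS --safe #-}
-- Let k be even, k ≥ 3.  Every ordered pair (a , b) of distinct vertices of K_n
-- gives the zigzag k-cycle i ↦ (i , a) for even i and (i , b) for odd i in C_k × K_n;
-- evenness of k makes the colouring of ℤ_k by parity proper, so consecutive vertices differ.
-- An edge (i , x) — (i + 1 , y) lies on the zigzag of (x , y) if i is even and of
-- (y , x) if i is odd, and on no other: a zigzag traversing it backwards would need
-- i + 2 ≡ i (mod k), i.e. k ∣ 2.
module Submission where

open import Defs
open import Data.Nat using (ℕ; suc; _+_; _*_; _<_; _≤_; _%_; _/_; NonZero; parity; z≤n; s≤s)
open import Data.Nat.DivMod using (m≡m%n+[m/n]*n; %-distribˡ-+; m%n%n≡m%n)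
open import Data.Nat.Divisibility using (divides; ∣⇒≤)
open import Data.Nat.Properties using (+-cancelˡ-≡; +-comm; <⇒≱)
open import Data.Fin using (Fin; toℕ; punchIn; punchOut)
open import Data.Fin.Properties using (toℕ-fromℕ<; punchInᵢ≢i; punchIn-injective; punchIn-punchOut; *↔×)
open import Data.Parity.Base using (Parity; 0ℙ; 1ℙ; _⁻¹) renaming (_+_ to _ℙ+_; _*_ to _ℙ*_)
open import Data.Parity.Properties using (+-homo-+; *-homo-*; suc-homo-⁻¹; ⁻¹-involutive; +-identityʳ; *-zeroʳ)
open import Data.Product using (_×_; Σ; ∃-syntax; _,_; proj₁; proj₂)
open import Data.Product.Properties using (,-injective)
open import Data.Sum using (inj₁; inj₂)
open import Data.Empty using (⊥; ⊥-elim)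
open import Function.Base using (_∘_)
open import Function.Bundles using (_↔_; Inverse)
open import Relation.Binary.PropositionalEquality using (_≡_; _≢_; refl; sym; trans; cong; subst; module ≡-Reasoning)

decomposition-via : ∀ {k} .{{_ : NonZero k}} {G : Graph} {s} {T : Set} → Fin s ↔ T →
  (cyc : T → CycleIn k G) →
  (∀ u v → Adj G u v → ∃[ t ] EdgeOf (cyc t) u v) →
  (∀ u v → Adj G u v → ∀ t t′ → EdgeOf (cyc t) u v → EdgeOf (cyc t′) u v → t ≡ t′) →
  Decomposition k G
decomposition-via enum cyc covers unique = record
  { size   = _
  ; cycle  = λ j → cyc (to j)
  ; covers = λ u v uv → let t , e = covers u v uv in
      from t , subst (λ t → EdgeOf (cyc t) u v) (sym (strictlyInverseˡ t)) e
  ; unique = λ u v uv j j′ e e′ → begin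
      j             ≡⟨ sym (strictlyInverseʳ j) ⟩
      from (to j)   ≡⟨ cong from (unique u v uv _ _ e e′) ⟩
      from (to j′)  ≡⟨ strictlyInverseʳ j′ ⟩
      j′            ∎
  }
  where open Inverse enum
        open ≡-Reasoning

parity[m%n]≡parity[m] : ∀ m n .{{_ : NonZero n}} → parity n ≡ 0ℙ →
                        parity (m % n) ≡ parity m
parity[m%n]≡parity[m] m n n-even = sym (begin
  parity m                                   ≡⟨ cong parity (m≡m%n+[m/n]*n m n) ⟩
  parity (m % n + m / n * n)                 ≡⟨ +-homo-+ (m % n) (m / n * n) ⟩
  parity (m % n) ℙ+ parity (m / n * n)       ≡⟨ cong (parity (m % n) ℙ+_) (*-homo-* (m / n) n) ⟩
  parity (m % n) ℙ+ (parity (m / n) ℙ* parity n) ≡⟨ cong (λ p → parity (m % n) ℙ+ (parity (m / n) ℙ* p)) n-even ⟩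
  parity (m % n) ℙ+ (parity (m / n) ℙ* 0ℙ)   ≡⟨ cong (parity (m % n) ℙ+_) (*-zeroʳ (parity (m / n))) ⟩
  parity (m % n) ℙ+ 0ℙ                       ≡⟨ +-identityʳ (parity (m % n)) ⟩
  parity (m % n)                             ∎)
  where open ≡-Reasoning

module _ {k : ℕ} .{{_ : NonZero k}} where

  toℕ-next : ∀ (i : Fin k) → toℕ (next i) ≡ suc (toℕ i) % k
  toℕ-next i = toℕ-fromℕ< _

  side : Fin k → Parity
  side i = parity (toℕ i)

  side-next : parity k ≡ 0ℙ → ∀ i → side (next i) ≡ side i ⁻¹
  side-next k-even i = begin
    parity (toℕ (next i))       ≡⟨ cong parity (toℕ-next i) ⟩
    parity (suc (toℕ i) % k)    ≡⟨ parity[m%n]≡parity[m] (suc (toℕ i)) k k-even ⟩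
    parity (suc (toℕ i))        ≡⟨ sym (⁻¹-involutive _) ⟩
    parity (suc (toℕ i)) ⁻¹ ⁻¹  ≡⟨ cong _⁻¹ (suc-homo-⁻¹ (toℕ i)) ⟩
    parity (toℕ i) ⁻¹           ∎
    where open ≡-Reasoning

  toℕ-next-next : ∀ (i : Fin k) → toℕ (next (next i)) ≡ (2 + toℕ i) % k
  toℕ-next-next i = begin
    toℕ (next (next i))               ≡⟨ toℕ-next (next i) ⟩
    (1 + toℕ (next i)) % k            ≡⟨ cong (λ m → (1 + m) % k) (toℕ-next i) ⟩
    (1 + (1 + a) % k) % k             ≡⟨ %-distribˡ-+ 1 ((1 + a) % k) k ⟩
    (1 % k + (1 + a) % k % k) % k     ≡⟨ cong (λ m → (1 % k + m) % k) (m%n%n≡m%n (1 + a) k) ⟩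
    (1 % k + (1 + a) % k) % k         ≡⟨ sym (%-distribˡ-+ 1 (1 + a) k) ⟩
    (2 + a) % k                       ∎
    where
      open ≡-Reasoning
      a : ℕ
      a = toℕ i

  next-next≢id : 3 ≤ k → ∀ (i : Fin k) → next (next i) ≢ i
  next-next≢id 3≤k i eq = <⇒≱ 3≤k (∣⇒≤ (divides ((2 + a) / k) 2≡q*k))
    where
      a : ℕ
      a = toℕ i
      2+a%k≡a : (2 + a) % k ≡ a
      2+a%k≡a = trans (sym (toℕ-next-next i)) (cong toℕ eq)
      2≡q*k : 2 ≡ (2 + a) / k * k
      2≡q*k = +-cancelˡ-≡ a 2 _ (begin
        a + 2                         ≡⟨ +-comm a 2 ⟩
        2 + a                         ≡⟨ m≡m%n+[m/n]*n (2 + a) k ⟩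
        (2 + a) % k + (2 + a) / k * k ≡⟨ cong (_+ (2 + a) / k * k) 2+a%k≡a ⟩
        a + (2 + a) / k * k           ∎)
        where open ≡-Reasoning

module _ {A : Set} where

  choose : Parity → A → A → A
  choose 0ℙ a b = a
  choose 1ℙ a b = b

  choose-≢ : ∀ {a b} → a ≢ b → ∀ p → choose p a b ≢ choose (p ⁻¹) a b
  choose-≢ a≢b 0ℙ = a≢b
  choose-≢ a≢b 1ℙ = a≢b ∘ sym

  choose-injective : ∀ p {a b a′ b′} → choose p a b ≡ choose p a′ b′ →
                     choose (p ⁻¹) a b ≡ choose (p ⁻¹) a′ b′ → a ≡ a′ × b ≡ b′
  choose-injective 0ℙ e e′ = e , e′
  choose-injective 1ℙ e e′ = e′ , e

  choose-swap-≢ : ∀ {x y} → x ≢ y → ∀ p → choose p x y ≢ choose p y x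
  choose-swap-≢ x≢y 0ℙ = x≢y
  choose-swap-≢ x≢y 1ℙ = x≢y ∘ sym

  choose-swap : ∀ p (x y : A) → choose p (choose p x y) (choose p y x) ≡ x
                              × choose (p ⁻¹) (choose p x y) (choose p y x) ≡ y
  choose-swap 0ℙ x y = refl , refl
  choose-swap 1ℙ x y = refl , refl

module Zigzag {k : ℕ} .{{_ : NonZero k}} (k-even : parity k ≡ 0ℙ) (3≤k : 3 ≤ k) {n : ℕ} where

  zigzag-vertex : Fin n → Fin n → Fin k → Fin k × Fin n
  zigzag-vertex a b i = i , choose (side i) a b

  zigzag : (a b : Fin n) → a ≢ b → CycleIn k (C k ⊗ K n)
  zigzag a b a≢b = record
    { vert     = zigzag-vertex a b
    ; distinct = cong proj₁
    ; adjacent = λ i → inj₁ refl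
                     , subst (λ p → choose (side i) a b ≢ choose p a b) (sym (side-next k-even i))
                             (choose-≢ a≢b (side i))
    }

  zigzag-aligned : ∀ {a b a′ b′ i j} → zigzag-vertex a b i ≡ zigzag-vertex a′ b′ j →
                   zigzag-vertex a b (next i) ≡ zigzag-vertex a′ b′ (next j) → a ≡ a′ × b ≡ b′
  zigzag-aligned {a} {b} {a′} {b′} {i} e e′ with ,-injective e | ,-injective e′
  ... | refl , x | _ , y =
    choose-injective (side i) x (subst (λ p → choose p a b ≡ choose p a′ b′) (side-next k-even i) y)

  zigzag-crossed : ∀ {a b a′ b′ i j} → zigzag-vertex a b i ≡ zigzag-vertex a′ b′ (next j) →
                   zigzag-vertex a b (next i) ≡ zigzag-vertex a′ b′ j → ⊥
  zigzag-crossed {j = j} e e′ =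
    next-next≢id 3≤k j (trans (cong next (sym (cong proj₁ e))) (cong proj₁ e′))

  zigzag-edge-unique : ∀ {a b a′ b′ u v} (a≢b : a ≢ b) (a′≢b′ : a′ ≢ b′) →
                       EdgeOf (zigzag a b a≢b) u v → EdgeOf (zigzag a′ b′ a′≢b′) u v →
                       a ≡ a′ × b ≡ b′
  zigzag-edge-unique _ _ (_ , inj₁ (p , p′)) (_ , inj₁ (q , q′)) =
    zigzag-aligned (trans p (sym q)) (trans p′ (sym q′))
  zigzag-edge-unique _ _ (_ , inj₂ (p , p′)) (_ , inj₂ (q , q′)) =
    zigzag-aligned (trans p (sym q)) (trans p′ (sym q′))
  zigzag-edge-unique _ _ (_ , inj₁ (p , p′)) (_ , inj₂ (q , q′)) =
    ⊥-elim (zigzag-crossed (trans p (sym q′)) (trans p′ (sym q)))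
  zigzag-edge-unique _ _ (_ , inj₂ (p , p′)) (_ , inj₁ (q , q′)) =
    ⊥-elim (zigzag-crossed (trans p (sym q′)) (trans p′ (sym q)))

  zigzag-through : ∀ i {x y} → x ≢ y →
                   ∃[ a ] ∃[ b ] a ≢ b × zigzag-vertex a b i ≡ (i , x) × zigzag-vertex a b (next i) ≡ (next i , y)
  zigzag-through i {x} {y} x≢y =
      choose (side i) x y , choose (side i) y x , choose-swap-≢ x≢y (side i)
    , cong (i ,_) (proj₁ (choose-swap (side i) x y))
    , cong (next i ,_) (trans (cong (λ p → choose p (choose (side i) x y) (choose (side i) y x))
                                    (side-next k-even i))
                              (proj₂ (choose-swap (side i) x y)))

  zigzag-covers : ∀ u v → Adj (C k ⊗ K n) u v →
                  ∃[ a ] ∃[ b ] Σ (a ≢ b) λ a≢b → EdgeOf (zigzag a b a≢b) u v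
  zigzag-covers (i , x) (_ , y) (inj₁ refl , x≢y) =
    let a , b , a≢b , p , p′ = zigzag-through i x≢y in a , b , a≢b , i , inj₁ (p , p′)
  zigzag-covers (_ , x) (j , y) (inj₂ refl , x≢y) =
    let a , b , a≢b , p , p′ = zigzag-through j (x≢y ∘ sym) in a , b , a≢b , j , inj₂ (p , p′)

C⊗K-decomposition : ∀ {k} .{{_ : NonZero k}} → parity k ≡ 0ℙ → 3 ≤ k →
                    ∀ m → Decomposition k (C k ⊗ K (suc m))
C⊗K-decomposition {k} k-even 3≤k m = decomposition-via *↔× arc-cycle covers unique
  where
    open Zigzag k-even 3≤k

    a≢punchIn : ∀ a (d : Fin m) → a ≢ punchIn a d
    a≢punchIn a d = punchInᵢ≢i a d ∘ sym

    arc-cycle : Fin (suc m) × Fin m → CycleIn k (C k ⊗ K (suc m))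
    arc-cycle (a , d) = zigzag a (punchIn a d) (a≢punchIn a d)

    covers : ∀ u v → Adj (C k ⊗ K (suc m)) u v → ∃[ t ] EdgeOf (arc-cycle t) u v
    covers u v uv with zigzag-covers u v uv
    ... | a , b , a≢b , e = (a , punchOut a≢b) , edge (a≢punchIn a (punchOut a≢b))
      where
        -- The edges of a zigzag do not depend on the proof that its ends differ.
        edge : ∀ (a≢b′ : a ≢ punchIn a (punchOut a≢b)) → EdgeOf (zigzag a _ a≢b′) u v
        edge = subst (λ b → (a≢b : a ≢ b) → EdgeOf (zigzag a b a≢b) u v)
                     (sym (punchIn-punchOut a≢b)) (λ _ → e)

    unique : ∀ u v → Adj (C k ⊗ K (suc m)) u v → ∀ t t′ →
             EdgeOf (arc-cycle t) u v → EdgeOf (arc-cycle t′) u v → t ≡ t′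
    unique _ _ _ (a , d) (a′ , d′) e e′
      with zigzag-edge-unique (a≢punchIn a d) (a≢punchIn a′ d′) e e′
    ... | refl , b≡b′ = cong (a ,_) (punchIn-injective a d d′ b≡b′)

theorem5p3 : ∀ (n : ℕ) → 0 < n → Decomposition 6 (C 6 ⊗ K n)
theorem5p3 (suc m) _ = C⊗K-decomposition refl (s≤s (s≤s (s≤s z≤n))) m
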